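{- For any Coxeter system $(W,S)$ with $S=\{s_0,\ldots,s_n\}$, one has $\mathtt{P}(W^+)s_0=\hat{\mathtt{T}}=s_0\mathtt{P}(W^+)$. In other words, an element $w\in W^+$ is a palindrome with respect to $R$ if and only if $ws_0$ (equivalently $s_0w$) lies in $\hat{\mathtt{T}}$.
   Context: $W^+=\ker\epsilon$ ($\epsilon(s)=-1$ for $s\in S$), generated by $R=\{r_1,\ldots,r_n\}$, $r_i=s_0s_i$. A palindrome is an element $g\in W^+$ factored by some word $(a_1,\ldots,a_\ell)$ in $R\cup R^{ -1}$ with $\ell$ odd and $a_{\ell+1-i}=a_i$ for all $i$; $\mathtt{P}(W^+)$ is the set of palindromes. $\hat{\mathtt{T}}=\{wsw^{ -1}:w\in W,\ s\in S\setminus\{s_0\}\}$. -}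

module Defs where

open import Data.Nat using (ℕ; zero; suc; _+_; _*_; _≤_)
open import Data.Fin using (Fin; zero; suc)
open import Data.List using (List; []; _∷_; _++_; reverse; length; concatMap)
open import Data.Maybe using (Maybe; just; nothing)
open import Data.Bool using (Bool; true; false)
open import Data.Product using (Σ; ∃; _×_; _,_)
open import Data.Sum using (_⊎_)
open import Relation.Binary.PropositionalEquality using (_≡_; _≢_)

-- A Coxeter matrix of rank n+1 on the index set {0,…,n} (generators s₀,…,sₙ).
-- m i j = nothing encodes m(sᵢ,sⱼ) = ∞.
record CoxeterMatrix (n : ℕ) : Set where
  field
    m     : Fin (suc n) → Fin (suc n) → Maybe ℕ
    diag  : ∀ i → m i i ≡ just 1
    symm  : ∀ i j → m i j ≡ m j i
    off   : ∀ i j → i ≢ j → ∀ k → m i j ≡ just k → 2 ≤ k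

rep : {A : Set} → ℕ → List A → List A
rep zero    xs = []
rep (suc k) xs = xs ++ rep k xs

OddN : ℕ → Set
OddN ℓ = ∃ λ k → ℓ ≡ suc (2 * k)

module Coxeter {n : ℕ} (M : CoxeterMatrix n) where
  open CoxeterMatrix M

  Word : Set
  Word = List (Fin (suc n))

  -- Equality in W = ⟨ S | (sᵢ sⱼ)^{m(i,j)} = 1 ⟩ : the congruence on words
  -- generated by the Coxeter relations (W is the quotient of words by it).
  infix 4 _≈_
  data _≈_ : Word → Word → Set where
    ≈-refl  : ∀ {u} → u ≈ u
    ≈-sym   : ∀ {u v} → u ≈ v → v ≈ u
    ≈-trans : ∀ {u v w} → u ≈ v → v ≈ w → u ≈ w
    ≈-rel   : ∀ u v i j k → m i j ≡ just k →
              (u ++ (rep k (i ∷ j ∷ []) ++ v)) ≈ (u ++ v)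

  s₀ : Fin (suc n)
  s₀ = zero

  _·_ : Word → Word → Word
  u · v = u ++ v

  inv : Word → Word
  inv = reverse

  -- Letters of the alphabet R ∪ R⁻¹ : (i , true) is r_{i+1} = s₀ s_{i+1},
  -- (i , false) is r_{i+1}⁻¹ = s_{i+1} s₀.
  Letter : Set
  Letter = Fin n × Bool

  ⟦_⟧ : Letter → Word
  ⟦ i , true  ⟧ = s₀ ∷ suc i ∷ []
  ⟦ i , false ⟧ = suc i ∷ s₀ ∷ []

  evalR : List Letter → Word
  evalR = concatMap ⟦_⟧

  -- W⁺ = ker ε : elements represented by words of even length
  InWPlus : Word → Set
  InWPlus g = ∃ λ k → length g ≡ 2 * k

  IsPalindrome : Word → Set
  IsPalindrome g = InWPlus g × (∃ λ (a : List Letter) →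
    OddN (length a) × reverse a ≡ a × g ≈ evalR a)

  InTHat : Word → Set
  InTHat t = ∃ λ (w : Word) → ∃ λ (i : Fin n) → t ≈ w · ((suc i ∷ []) · inv w)

{-# OPTIONS --safe #-}
-- Conjugation by s₀ turns each rᵢ = s₀sᵢ into sᵢs₀ = rᵢ⁻¹. So for an odd palindrome
-- y c ȳ (ȳ the reversed word, Y the value of y) one gets y c ȳ s₀ = Y (c s₀) Y⁻¹, and c s₀ is either
-- s₀ sᵢ s₀ or sᵢ; hence P(W⁺) s₀ ⊆ T̂. Conversely P(W⁺) s₀ contains every sᵢ = rᵢ⁻¹ s₀ and is closed
-- under conjugation by generators: s₀ (p s₀) s₀ = p̂ s₀ and sᵢ (p s₀) sᵢ = rᵢ⁻¹ p̂ rᵢ⁻¹ s₀, where p̂ is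
-- p with every letter inverted. The statements with s₀ on the left follow from s₀ p = p̂ s₀.
module Submission where

open import Defs
open import Data.Nat using (ℕ; zero; suc; _+_; _*_)
open import Data.Nat.Properties using (+-suc; +-identityʳ; *-suc; suc-injective)
open import Data.Fin using (zero; suc)
open import Data.Bool using (true; false; not)
open import Data.Bool.Properties using (not-involutive)
open import Data.List using (List; []; _∷_; [_]; _++_; _∷ʳ_; reverse; length; map; concatMap)
open import Data.List.Properties
  using (++-assoc; ++-identityʳ; length-++-comm; length-map; length-reverse; map-∘; map-id; map-cong;
         reverse-map; reverse-++; unfold-reverse; reverse-selfInverse; ++-ʳ++; ʳ++-defn; ∷-injectiveˡ; ∷-injectiveʳ;
         concatMap-++; concatMap-map; concatMap-cong)
open import Data.Maybe using (just)
open import Data.Product using (∃; _×_; _,_)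
open import Function using (_∘_)
open import Relation.Binary.Bundles using (Setoid)
open import Relation.Binary.Structures using (IsEquivalence)
open import Relation.Binary.PropositionalEquality using (_≡_; refl; sym; trans; cong; cong₂; module ≡-Reasoning)

private
  variable
    A B : Set

IsOddPalindrome : List A → Set
IsOddPalindrome a = OddN (length a) × reverse a ≡ a

reverse-centred : ∀ (y : List A) c z → reverse (y ++ c ∷ z) ≡ reverse z ++ c ∷ reverse y
reverse-centred y c z = trans (++-ʳ++ y) (ʳ++-defn z)

splitAround : ∀ k m (a : List A) → length a ≡ k + suc m →
              ∃ λ y → ∃ λ c → ∃ λ z → a ≡ y ++ c ∷ z × length y ≡ k × length z ≡ m
splitAround zero    m (c ∷ z) len = [] , c , z , refl , refl , suc-injective len
splitAround (suc k) m (x ∷ a) len with splitAround k m a (suc-injective len)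
... | y , c , z , refl , ∣y∣ , ∣z∣ = x ∷ y , c , z , refl , cong suc ∣y∣ , ∣z∣

++-injectiveˡ : ∀ (xs ys : List A) {zs ws} → length xs ≡ length ys → xs ++ zs ≡ ys ++ ws → xs ≡ ys
++-injectiveˡ []       []       _   _  = refl
++-injectiveˡ (x ∷ xs) (y ∷ ys) len eq =
  cong₂ _∷_ (∷-injectiveˡ eq) (++-injectiveˡ xs ys (suc-injective len) (∷-injectiveʳ eq))

oddPalindrome-centred : {a : List A} → IsOddPalindrome a → ∃ λ y → ∃ λ c → a ≡ y ++ c ∷ reverse y
oddPalindrome-centred {a = a} ((k , len) , rev)
  with splitAround k (k + 0) a (trans len (sym (+-suc k (k + 0))))
... | y , c , z , refl , ∣y∣ , ∣z∣ = y , c , cong (λ u → y ++ c ∷ u) (sym (reverse-selfInverse reverse-z≡y))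
  where
  reverse-z≡y : reverse z ≡ y
  reverse-z≡y = ++-injectiveˡ (reverse z) y
    (trans (length-reverse z) (trans ∣z∣ (trans (+-identityʳ k) (sym ∣y∣))))
    (trans (sym (reverse-centred y c z)) rev)

oddPalindrome-[_] : (c : A) → IsOddPalindrome [ c ]
oddPalindrome-[ c ] = (0 , refl) , refl

oddPalindrome-wrap : (x : A) {a : List A} → IsOddPalindrome a → IsOddPalindrome (x ∷ a ++ [ x ])
oddPalindrome-wrap x {a = a} ((k , len) , rev) = (suc k , cong suc len′) , rev′
  where
  len′ : length (a ++ [ x ]) ≡ suc k + (suc k + 0)
  len′ = trans (length-++-comm a [ x ]) (cong suc (trans len (sym (+-suc k (k + 0)))))
  rev′ : reverse (x ∷ a ++ [ x ]) ≡ x ∷ a ++ [ x ]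
  rev′ = trans (reverse-centred (x ∷ a) x []) (cong (x ∷_) (trans (unfold-reverse x a) (cong (_∷ʳ x) rev)))

oddPalindrome-map : (f : A → B) {a : List A} → IsOddPalindrome a → IsOddPalindrome (map f a)
oddPalindrome-map f {a = a} ((k , len) , rev) =
  (k , trans (length-map f a) len) , trans (sym (reverse-map f a)) (cong (map f) rev)

conj : List A → List A → List A
conj u t = u ++ t ++ reverse u

conj-++ : ∀ (u w t : List A) → conj u (conj w t) ≡ conj (u ++ w) t
conj-++ u w t = begin
  u ++ (w ++ t ++ reverse w) ++ reverse u   ≡⟨ cong (u ++_) (++-assoc w _ (reverse u)) ⟩
  u ++ w ++ (t ++ reverse w) ++ reverse u   ≡⟨ cong (λ r → u ++ w ++ r) (++-assoc t (reverse w) (reverse u)) ⟩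
  u ++ w ++ t ++ reverse w ++ reverse u     ≡⟨ ++-assoc u w _ ⟨
  (u ++ w) ++ t ++ reverse w ++ reverse u   ≡⟨ cong (λ r → (u ++ w) ++ t ++ r) (reverse-++ u w) ⟨
  (u ++ w) ++ t ++ reverse (u ++ w)         ∎
  where open ≡-Reasoning

reverse-concatMap : (f : A → List B) (xs : List A) →
                    reverse (concatMap f xs) ≡ concatMap (reverse ∘ f) (reverse xs)
reverse-concatMap f []       = refl
reverse-concatMap f (x ∷ xs) = begin
  reverse (f x ++ concatMap f xs)                              ≡⟨ reverse-++ (f x) _ ⟩
  reverse (concatMap f xs) ++ reverse (f x)                    ≡⟨ cong₂ _++_ (reverse-concatMap f xs) (sym (++-identityʳ _)) ⟩
  concatMap (reverse ∘ f) (reverse xs) ++ reverse (f x) ++ []  ≡⟨ concatMap-++ (reverse ∘ f) (reverse xs) [ x ] ⟨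
  concatMap (reverse ∘ f) (reverse xs ∷ʳ x)                    ≡⟨ cong (concatMap (reverse ∘ f)) (unfold-reverse x xs) ⟨
  concatMap (reverse ∘ f) (reverse (x ∷ xs))                   ∎
  where open ≡-Reasoning

module _ {n : ℕ} (M : CoxeterMatrix n) where
  open CoxeterMatrix M
  open Coxeter M

  ≈-isEquivalence : IsEquivalence _≈_
  ≈-isEquivalence = record { refl = ≈-refl ; sym = ≈-sym ; trans = ≈-trans }

  ≈-setoid : Setoid _ _
  ≈-setoid = record { isEquivalence = ≈-isEquivalence }

  open import Relation.Binary.Reasoning.Setoid ≈-setoid

  ≈-reflexive : ∀ {u v} → u ≡ v → u ≈ v
  ≈-reflexive refl = ≈-refl

  ≈-cong-byRelators : (f : Word → Word) →
    (∀ u v i j k → m i j ≡ just k → f (u ++ rep k (i ∷ j ∷ []) ++ v) ≈ f (u ++ v)) →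
    ∀ {u v} → u ≈ v → f u ≈ f v
  ≈-cong-byRelators f f-rel ≈-refl                = ≈-refl
  ≈-cong-byRelators f f-rel (≈-sym e)             = ≈-sym (≈-cong-byRelators f f-rel e)
  ≈-cong-byRelators f f-rel (≈-trans e e′)        = ≈-trans (≈-cong-byRelators f f-rel e) (≈-cong-byRelators f f-rel e′)
  ≈-cong-byRelators f f-rel (≈-rel u v i j k m≡k) = f-rel u v i j k m≡k

  ++-congˡ : ∀ p {u v} → u ≈ v → p ++ u ≈ p ++ v
  ++-congˡ p = ≈-cong-byRelators (p ++_) λ u v i j k m≡k → begin
    p ++ u ++ rep k (i ∷ j ∷ []) ++ v   ≡⟨ ++-assoc p u _ ⟨
    (p ++ u) ++ rep k (i ∷ j ∷ []) ++ v ≈⟨ ≈-rel (p ++ u) v i j k m≡k ⟩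
    (p ++ u) ++ v                       ≡⟨ ++-assoc p u v ⟩
    p ++ u ++ v                         ∎

  ++-congʳ : ∀ q {u v} → u ≈ v → u ++ q ≈ v ++ q
  ++-congʳ q = ≈-cong-byRelators (_++ q) λ u v i j k m≡k → begin
    (u ++ rep k (i ∷ j ∷ []) ++ v) ++ q ≡⟨ ++-assoc u _ q ⟩
    u ++ (rep k (i ∷ j ∷ []) ++ v) ++ q ≡⟨ cong (u ++_) (++-assoc (rep k (i ∷ j ∷ [])) v q) ⟩
    u ++ rep k (i ∷ j ∷ []) ++ v ++ q   ≈⟨ ≈-rel u (v ++ q) i j k m≡k ⟩
    u ++ v ++ q                         ≡⟨ ++-assoc u v q ⟨
    (u ++ v) ++ q                       ∎

  generator-cancel : ∀ i p q → p ++ i ∷ i ∷ q ≈ p ++ q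
  generator-cancel i p q = ≈-rel p q i i 1 (diag i)

  invert : Letter → Letter
  invert (i , b) = i , not b

  map-invert-involutive : ∀ a → map invert (map invert a) ≡ a
  map-invert-involutive a =
    trans (sym (map-∘ a)) (trans (map-cong (λ (i , b) → cong (i ,_) (not-involutive b)) a) (map-id a))

  ⟦invert⟧ : ∀ ℓ → ⟦ invert ℓ ⟧ ≡ reverse ⟦ ℓ ⟧
  ⟦invert⟧ (i , true)  = refl
  ⟦invert⟧ (i , false) = refl

  evalR-invert-reverse : ∀ a → evalR (map invert (reverse a)) ≡ reverse (evalR a)
  evalR-invert-reverse a =
    trans (concatMap-map ⟦_⟧ invert (reverse a))
          (trans (concatMap-cong ⟦invert⟧ (reverse a)) (sym (reverse-concatMap ⟦_⟧ a)))

  length-evalR : ∀ a → length (evalR a) ≡ 2 * length a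
  length-evalR []                = refl
  length-evalR ((_ , true)  ∷ a) = trans (cong (2 +_) (length-evalR a)) (sym (*-suc 2 (length a)))
  length-evalR ((_ , false) ∷ a) = trans (cong (2 +_) (length-evalR a)) (sym (*-suc 2 (length a)))

  evalR-isPalindrome : ∀ {a} → IsOddPalindrome a → IsPalindrome (evalR a)
  evalR-isPalindrome {a} (odd , rev) = (length a , length-evalR a) , a , odd , rev , ≈-refl

  ⟦⟧-s₀ : ∀ ℓ q → ⟦ ℓ ⟧ ++ s₀ ∷ q ≈ s₀ ∷ ⟦ invert ℓ ⟧ ++ q
  ⟦⟧-s₀ (i , true)  q = ≈-refl
  ⟦⟧-s₀ (i , false) q = ≈-trans (generator-cancel s₀ [ suc i ] q) (≈-sym (generator-cancel s₀ [] (suc i ∷ q)))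

  evalR-s₀ : ∀ a q → evalR a ++ s₀ ∷ q ≈ s₀ ∷ evalR (map invert a) ++ q
  evalR-s₀ []      q = ≈-refl
  evalR-s₀ (ℓ ∷ a) q = begin
    (⟦ ℓ ⟧ ++ evalR a) ++ s₀ ∷ q                     ≡⟨ ++-assoc ⟦ ℓ ⟧ (evalR a) _ ⟩
    ⟦ ℓ ⟧ ++ evalR a ++ s₀ ∷ q                       ≈⟨ ++-congˡ ⟦ ℓ ⟧ (evalR-s₀ a q) ⟩
    ⟦ ℓ ⟧ ++ s₀ ∷ evalR (map invert a) ++ q          ≈⟨ ⟦⟧-s₀ ℓ _ ⟩
    s₀ ∷ ⟦ invert ℓ ⟧ ++ evalR (map invert a) ++ q   ≡⟨ cong (s₀ ∷_) (++-assoc ⟦ invert ℓ ⟧ _ q) ⟨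
    s₀ ∷ evalR (map invert (ℓ ∷ a)) ++ q             ∎

  evalR·s₀ : ∀ a → evalR a ++ [ s₀ ] ≈ s₀ ∷ evalR (map invert a)
  evalR·s₀ a = ≈-trans (evalR-s₀ a []) (≈-reflexive (cong (s₀ ∷_) (++-identityʳ _)))

  s₀·evalR : ∀ a → s₀ ∷ evalR a ≈ evalR (map invert a) ++ [ s₀ ]
  s₀·evalR a = begin
    s₀ ∷ evalR a                                ≡⟨ cong (λ b → s₀ ∷ evalR b) (map-invert-involutive a) ⟨
    s₀ ∷ evalR (map invert (map invert a))      ≈⟨ evalR·s₀ (map invert a) ⟨
    evalR (map invert a) ++ [ s₀ ]              ∎

  InTHat-resp-≈ : ∀ {t t′} → t ≈ t′ → InTHat t → InTHat t′
  InTHat-resp-≈ t≈t′ (w , i , e) = w , i , ≈-trans (≈-sym t≈t′) e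

  InTHat-conj : ∀ u {t} → InTHat t → InTHat (conj u t)
  InTHat-conj u {t} (w , i , e) = u ++ w , i , (begin
    conj u t                    ≈⟨ ++-congˡ u (++-congʳ (reverse u) e) ⟩
    conj u (conj w [ suc i ])   ≡⟨ conj-++ u w [ suc i ] ⟩
    conj (u ++ w) [ suc i ]     ∎)

  ⟦⟧·s₀∈T̂ : ∀ c → InTHat (⟦ c ⟧ ++ [ s₀ ])
  ⟦⟧·s₀∈T̂ (i , true)  = [ s₀ ] , i , ≈-refl
  ⟦⟧·s₀∈T̂ (i , false) = [] , i , generator-cancel s₀ [ suc i ] []

  oddPalindrome·s₀∈T̂ : ∀ {a} → IsOddPalindrome a → InTHat (evalR a ++ [ s₀ ])
  oddPalindrome·s₀∈T̂ pal with oddPalindrome-centred pal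
  ... | y , c , refl = InTHat-resp-≈ (≈-sym centred·s₀) (InTHat-conj (evalR y) (⟦⟧·s₀∈T̂ c))
    where
    Y = evalR y
    centred·s₀ : evalR (y ++ c ∷ reverse y) ++ [ s₀ ] ≈ conj Y (⟦ c ⟧ ++ [ s₀ ])
    centred·s₀ = begin
      evalR (y ++ c ∷ reverse y) ++ [ s₀ ]               ≡⟨ cong (_++ [ s₀ ]) (concatMap-++ ⟦_⟧ y (c ∷ reverse y)) ⟩
      (Y ++ ⟦ c ⟧ ++ evalR (reverse y)) ++ [ s₀ ]        ≡⟨ trans (++-assoc Y _ _) (cong (Y ++_) (++-assoc ⟦ c ⟧ _ _)) ⟩
      Y ++ ⟦ c ⟧ ++ evalR (reverse y) ++ [ s₀ ]          ≈⟨ ++-congˡ Y (++-congˡ ⟦ c ⟧ (evalR·s₀ (reverse y))) ⟩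
      Y ++ ⟦ c ⟧ ++ s₀ ∷ evalR (map invert (reverse y))  ≡⟨ cong (λ r → Y ++ ⟦ c ⟧ ++ s₀ ∷ r) (evalR-invert-reverse y) ⟩
      Y ++ ⟦ c ⟧ ++ s₀ ∷ reverse Y                       ≡⟨ cong (Y ++_) (++-assoc ⟦ c ⟧ [ s₀ ] (reverse Y)) ⟨
      conj Y (⟦ c ⟧ ++ [ s₀ ])                           ∎

  -- P(W⁺) s₀, with W⁺-membership dropped since it is automatic for words in R ∪ R⁻¹ (evalR-isPalindrome).
  InP·s₀ : Word → Set
  InP·s₀ t = ∃ λ a → IsOddPalindrome a × t ≈ evalR a ++ [ s₀ ]

  InP·s₀-resp-≈ : ∀ {t t′} → t ≈ t′ → InP·s₀ t → InP·s₀ t′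
  InP·s₀-resp-≈ t≈t′ (a , pal , e) = a , pal , ≈-trans (≈-sym t≈t′) e

  generator∈P·s₀ : ∀ i → InP·s₀ [ suc i ]
  generator∈P·s₀ i = [ i , false ] , oddPalindrome-[ _ ] , ≈-sym (generator-cancel s₀ [ suc i ] [])

  P·s₀-conj-generator : ∀ j {t} → InP·s₀ t → InP·s₀ (conj [ j ] t)
  P·s₀-conj-generator zero {t} (a , pal , e) = map invert a , oddPalindrome-map invert pal , (begin
    s₀ ∷ t ++ [ s₀ ]                      ≈⟨ ++-congˡ [ s₀ ] (++-congʳ [ s₀ ] e) ⟩
    s₀ ∷ (evalR a ++ [ s₀ ]) ++ [ s₀ ]    ≡⟨ cong (s₀ ∷_) (++-assoc (evalR a) [ s₀ ] [ s₀ ]) ⟩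
    (s₀ ∷ evalR a) ++ s₀ ∷ s₀ ∷ []        ≈⟨ generator-cancel s₀ (s₀ ∷ evalR a) [] ⟩
    (s₀ ∷ evalR a) ++ []                  ≡⟨ ++-identityʳ _ ⟩
    s₀ ∷ evalR a                          ≈⟨ s₀·evalR a ⟩
    evalR (map invert a) ++ [ s₀ ]        ∎)
  P·s₀-conj-generator (suc k) {t} (a , pal , e) =
    x ∷ a′ ++ [ x ] , oddPalindrome-wrap x (oddPalindrome-map invert pal) , (begin
      suc k ∷ t ++ [ suc k ]                             ≈⟨ ++-congˡ [ suc k ] (++-congʳ [ suc k ] (≈-trans e (evalR·s₀ a))) ⟩
      suc k ∷ s₀ ∷ E ++ [ suc k ]                        ≡⟨ ++-identityʳ _ ⟨
      (suc k ∷ s₀ ∷ E ++ [ suc k ]) ++ []                ≈⟨ generator-cancel s₀ (suc k ∷ s₀ ∷ E ++ [ suc k ]) [] ⟨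
      (suc k ∷ s₀ ∷ E ++ [ suc k ]) ++ s₀ ∷ s₀ ∷ []      ≡⟨ cong (λ r → suc k ∷ s₀ ∷ r) (++-assoc E [ suc k ] _) ⟩
      suc k ∷ s₀ ∷ E ++ suc k ∷ s₀ ∷ s₀ ∷ []             ≡⟨ cong (λ r → suc k ∷ s₀ ∷ r) (++-assoc E ⟦ x ⟧ [ s₀ ]) ⟨
      suc k ∷ s₀ ∷ (E ++ ⟦ x ⟧) ++ [ s₀ ]                ≡⟨ cong (λ r → suc k ∷ s₀ ∷ r ++ [ s₀ ]) (concatMap-++ ⟦_⟧ a′ [ x ]) ⟨
      evalR (x ∷ a′ ++ [ x ]) ++ [ s₀ ]                  ∎)
    where
    x  = k , false
    a′ = map invert a
    E  = evalR a′

  P·s₀-conj : ∀ w {t} → InP·s₀ t → InP·s₀ (conj w t)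
  P·s₀-conj []      {t} p = InP·s₀-resp-≈ (≈-reflexive (sym (++-identityʳ t))) p
  P·s₀-conj (j ∷ w) {t} p =
    InP·s₀-resp-≈ (≈-reflexive (conj-++ [ j ] w t)) (P·s₀-conj-generator j (P·s₀-conj w p))

  T̂⊆P·s₀ : ∀ {t} → InTHat t → InP·s₀ t
  T̂⊆P·s₀ (w , i , e) = InP·s₀-resp-≈ (≈-sym e) (P·s₀-conj w (generator∈P·s₀ i))

  palindrome·s₀∈T̂ : ∀ g → IsPalindrome g → InTHat (g · [ s₀ ])
  palindrome·s₀∈T̂ g (_ , a , odd , rev , g≈a) =
    InTHat-resp-≈ (++-congʳ [ s₀ ] (≈-sym g≈a)) (oddPalindrome·s₀∈T̂ (odd , rev))

  s₀·palindrome∈T̂ : ∀ g → IsPalindrome g → InTHat ([ s₀ ] · g)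
  s₀·palindrome∈T̂ g (_ , a , odd , rev , g≈a) =
    InTHat-resp-≈ (≈-sym (≈-trans (++-congˡ [ s₀ ] g≈a) (s₀·evalR a)))
                  (oddPalindrome·s₀∈T̂ (oddPalindrome-map invert (odd , rev)))

  T̂⊆palindromes·s₀ : ∀ t → InTHat t → ∃ λ g → IsPalindrome g × t ≈ g · [ s₀ ]
  T̂⊆palindromes·s₀ t t∈T̂ with T̂⊆P·s₀ t∈T̂
  ... | a , pal , t≈a·s₀ = evalR a , evalR-isPalindrome pal , t≈a·s₀

  T̂⊆s₀·palindromes : ∀ t → InTHat t → ∃ λ g → IsPalindrome g × t ≈ [ s₀ ] · g
  T̂⊆s₀·palindromes t t∈T̂ with T̂⊆P·s₀ t∈T̂
  ... | a , pal , t≈a·s₀ =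
    evalR (map invert a) , evalR-isPalindrome (oddPalindrome-map invert pal) , ≈-trans t≈a·s₀ (evalR·s₀ a)

proposition2p23 : ∀ (n : ℕ) (M : CoxeterMatrix n) → let open Coxeter M in
    -- P(W⁺) s₀ = T̂
    ((∀ g → IsPalindrome g → InTHat (g · (s₀ ∷ [])))
     × (∀ t → InTHat t → ∃ λ g → IsPalindrome g × t ≈ g · (s₀ ∷ [])))
    -- T̂ = s₀ P(W⁺)
    × ((∀ g → IsPalindrome g → InTHat ((s₀ ∷ []) · g))
     × (∀ t → InTHat t → ∃ λ g → IsPalindrome g × t ≈ (s₀ ∷ []) · g))
proposition2p23 n M =
  (palindrome·s₀∈T̂ M , T̂⊆palindromes·s₀ M) , (s₀·palindrome∈T̂ M , T̂⊆s₀·palindromes M)
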